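{- If $\lambda/\mu$ is a right-aligned skew Ferrers matrix of size $n\times n$, then $\mathfrak{S}(\lambda/\mu)$ is an order ideal (a downward closed subset) of $\mathfrak{S}_n$ in the Bruhat order.
   Context: A zero-one matrix $\lambda$ is a right-aligned Ferrers matrix if every one-entry has one-entries directly to its right and directly above it, whenever those entries exist. A right-aligned skew Ferrers matrix $\lambda/\mu$ is the difference $\lambda-\mu$ where $\lambda,\mu$ are right-aligned Ferrers matrices of the same size with $\mu\le\lambda$ entrywise. For an $n\times n$ zero-one matrix $A$, $\mathfrak{S}(A)$ is the set of $\pi\in\mathfrak{S}_n$ with $A_{i,\pi(i)}=1$ for all $i$ (rows indexed by $i$, columns by $j=\pi(i)$). Bruhat order is the usual one on $\mathfrak{S}_n$; equivalently $\sigma\le\rho$ iff $|\{a\le i:\sigma(a)\ge j\}|\le|\{a\le i:\rho(a)\ge j\}|$ for all $i,j$. -}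

module Defs where

open import Data.Nat using (ℕ; suc; _≤_)
open import Data.Nat.Properties using (_≤?_)
open import Data.Bool using (Bool; true; false; _∧_; not)
open import Data.Fin using (Fin; toℕ)
open import Data.List using (List; length; filter; allFin)
open import Data.Product using (_×_)
open import Relation.Nullary.Decidable using (_×-dec_)
open import Relation.Binary.PropositionalEquality using (_≡_)
open import Data.Fin.Permutation using (Permutation′; _⟨$⟩ʳ_)

-- n×n zero-one matrix: entry (i , j) = row i (top to bottom), column j.
Matrix : ℕ → Set
Matrix n = Fin n → Fin n → Bool

RightFerrers : ∀ {n} → Matrix n → Set
RightFerrers {n} A =
  ∀ (i j : Fin n) → A i j ≡ true →
    ((j′ : Fin n) → toℕ j′ ≡ suc (toℕ j) → A i j′ ≡ true)
  × ((i′ : Fin n) → suc (toℕ i′) ≡ toℕ i → A i′ j ≡ true)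

_≤ₘ_ : ∀ {n} → Matrix n → Matrix n → Set
_≤ₘ_ {n} M L = ∀ (i j : Fin n) → M i j ≡ true → L i j ≡ true

_∖ₘ_ : ∀ {n} → Matrix n → Matrix n → Matrix n
(L ∖ₘ M) i j = L i j ∧ not (M i j)

InS : ∀ {n} → Matrix n → Permutation′ n → Set
InS {n} A π = ∀ (i : Fin n) → A i (π ⟨$⟩ʳ i) ≡ true

rankCount : ∀ {n} → Permutation′ n → Fin n → Fin n → ℕ
rankCount {n} σ i j =
  length (filter (λ a → (toℕ a ≤? toℕ i) ×-dec (toℕ j ≤? toℕ (σ ⟨$⟩ʳ a))) (allFin n))

-- Bruhat order via the rank-count criterion
_≤B_ : ∀ {n} → Permutation′ n → Permutation′ n → Set
_≤B_ {n} σ ρ = ∀ (i j : Fin n) → rankCount σ i j ≤ rankCount ρ i j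

-- View a permutation π as the cells (a, π a) of the n×n grid. Because λ and μ are
-- right-aligned Ferrers, the ones of μ are closed under moving north-east and the zeros
-- of λ under moving south-west. So if σ(i) = c lies outside λ/μ, the permutation matrix
-- of ρ must avoid either the rectangle north-east of (i, c), which is full of ones of μ,
-- or the rectangle south-west of it, which is full of zeros of λ, while σ does not. The
-- rank counts of the Bruhat criterion show that σ ≤ ρ forbids both: the north-east
-- count of σ is bounded by that of ρ, and by inclusion–exclusion so is the count of the
-- strictly south-west rectangle at (i - 1, c + 1).
module Submission where

open import Defs
open import Data.Nat using (ℕ)
open import Data.Fin.Permutation using (Permutation′)

open import Data.Bool using (true; false; _∧_; not)
open import Data.Bool.Properties using (¬-not; not-¬)
open import Data.Fin using (Fin; zero; suc; toℕ; fromℕ<; inject₁; _≟_)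
open import Data.Fin.Induction using (<-weakInduction-startingFrom)
open import Data.Fin.Permutation using (_⟨$⟩ʳ_; _⟨$⟩ˡ_; inverseʳ; flip)
open import Data.Fin.Properties using (toℕ<n; toℕ-fromℕ<; toℕ-inject₁)
open import Data.List using (List; []; _∷_; length; filter; map; allFin)
open import Data.List.Membership.Propositional using (lose)
open import Data.List.Membership.Propositional.Properties
  using (∈-filter⁺; ∈-filter⁻; ∈-allFin; ∈-map⁻)
open import Data.List.Properties using (filter-some; filter-none; filter-notAll; length-map)
open import Data.List.Relation.Binary.Subset.Propositional using (_⊆_)
open import Data.List.Relation.Unary.All as All using ()
open import Data.List.Relation.Unary.AllPairs using (_∷_)
open import Data.List.Relation.Unary.Any as Any using (here; there)
open import Data.List.Relation.Unary.Unique.Propositional using (Unique)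
import Data.List.Relation.Unary.Unique.Propositional.Properties as Unique
open import Data.Nat using (zero; suc; _+_; _≤_; _<_; z≤n; s≤s)
open import Data.Nat.Properties
  using ( _≤?_; ≤-refl; ≤-reflexive; ≤-trans; ≤-antisym; <-≤-trans; ≤-pred; ≰⇒>; <⇒≱
        ; n≮n; +-suc; +-monoˡ-≤; +-cancelˡ-≤; module ≤-Reasoning)
open import Data.Product using (_×_; _,_; proj₁; proj₂; Σ-syntax)
open import Function using (_∘_; id)
open import Function.Bundles using (Injection)
open import Function.Definitions using (Injective)
open import Function.Properties.Inverse using (↔⇒↣)
open import Level using (Level)
open import Relation.Binary.Definitions using (DecidableEquality)
open import Relation.Binary.PropositionalEquality
open import Relation.Nullary using (¬_; ¬?; yes; no)
open import Relation.Unary using (Pred; Decidable)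
open import Relation.Unary.Properties using (_∩?_; ∁?)

private
  variable
    a p q : Level

module _ {A : Set a} (_≟ᴬ_ : DecidableEquality A) where

  unique-⊆⇒length-≤ : {xs ys : List A} → Unique xs → xs ⊆ ys → length xs ≤ length ys
  unique-⊆⇒length-≤ {[]}     _              _     = z≤n
  unique-⊆⇒length-≤ {x ∷ xs} {ys} (x∉xs ∷ xs!) xs⊆ys = begin-strict
    length xs              ≤⟨ unique-⊆⇒length-≤ xs! xs⊆ys∖x ⟩
    length (filter x≢? ys) <⟨ filter-notAll x≢? ys x∈ys ⟩
    length ys              ∎
    where
    open ≤-Reasoning
    x≢? : Decidable (λ y → ¬ x ≡ y)
    x≢? y = ¬? (x ≟ᴬ y)
    x∈ys : Any.Any (λ y → ¬ ¬ x ≡ y) ys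
    x∈ys = Any.map (λ x≡y x≢y → x≢y x≡y) (xs⊆ys (here refl))
    xs⊆ys∖x : xs ⊆ filter x≢? ys
    xs⊆ys∖x y∈xs = ∈-filter⁺ x≢? (xs⊆ys (there y∈xs)) (All.lookup x∉xs y∈xs)

module _ {A : Set a} {P : Pred A p} {Q : Pred A q} (P? : Decidable P) (Q? : Decidable Q) where

  length-filter-inclusion-exclusion : ∀ xs →
    length (filter (P? ∩? Q?) xs) + length (filter (∁? Q?) xs)
      ≡ length (filter P? xs) + length (filter (∁? P? ∩? ∁? Q?) xs)
  length-filter-inclusion-exclusion [] = refl
  length-filter-inclusion-exclusion (x ∷ xs)
    with ih ← length-filter-inclusion-exclusion xs | P? x | Q? x
  ... | yes _ | yes _ = cong suc ih
  ... | yes _ | no  _ = trans (+-suc _ _) (cong suc ih)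
  ... | no  _ | yes _ = ih
  ... | no  _ | no  _ = trans (+-suc _ _) (trans (cong suc ih) (sym (+-suc _ _)))

module _ {m n : ℕ} {P : Pred (Fin m) p} {Q : Pred (Fin n) q}
         (P? : Decidable P) (Q? : Decidable Q) where

  length-filter-≤-injective : {f : Fin m → Fin n} → Injective _≡_ _≡_ f →
    (∀ {a} → P a → Q (f a)) →
    length (filter P? (allFin m)) ≤ length (filter Q? (allFin n))
  length-filter-≤-injective {f} f-injective P⇒Q∘f = begin
    length (filter P? (allFin m))         ≡⟨ length-map f (filter P? (allFin m)) ⟨
    length (map f (filter P? (allFin m))) ≤⟨ unique-⊆⇒length-≤ _≟_ image-unique image⊆ ⟩
    length (filter Q? (allFin n))         ∎
    where
    open ≤-Reasoning
    image-unique : Unique (map f (filter P? (allFin m)))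
    image-unique = Unique.map⁺ f-injective (Unique.filter⁺ P? (Unique.allFin⁺ m))
    image⊆ : map f (filter P? (allFin m)) ⊆ filter Q? (allFin n)
    image⊆ y∈image with a , a∈ , refl ← ∈-map⁻ f y∈image =
      ∈-filter⁺ Q? (∈-allFin (f a)) (P⇒Q∘f (proj₂ (∈-filter⁻ P? {xs = allFin m} a∈)))

  length-filter-≤⇒∁-universal : length (filter P? (allFin m)) ≤ length (filter Q? (allFin n)) →
    (∀ b → ¬ Q b) → ∀ a → ¬ P a
  length-filter-≤⇒∁-universal |P|≤|Q| ∁Q a Pa = n≮n 0 (begin-strict
    0                             <⟨ filter-some P? (lose (∈-allFin a) Pa) ⟩
    length (filter P? (allFin m)) ≤⟨ |P|≤|Q| ⟩
    length (filter Q? (allFin n)) ≡⟨ cong length (filter-none Q? (All.universal ∁Q (allFin n))) ⟩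
    0                             ∎)
    where open ≤-Reasoning

length-filter-permute : ∀ {n} {Q : Pred (Fin n) q} (Q? : Decidable Q) (π : Permutation′ n) →
  length (filter (Q? ∘ (π ⟨$⟩ʳ_)) (allFin n)) ≡ length (filter Q? (allFin n))
length-filter-permute {Q = Q} Q? π = ≤-antisym
  (length-filter-≤-injective _ Q? (Injection.injective (↔⇒↣ π)) id)
  (length-filter-≤-injective Q? _ (Injection.injective (↔⇒↣ (flip π)))
    (subst Q (sym (inverseʳ π))))

predecessor : ∀ {n} (i : Fin n) → 0 < toℕ i → Σ[ i′ ∈ Fin n ] suc (toℕ i′) ≡ toℕ i
predecessor zero    ()
predecessor (suc i) _ = inject₁ i , cong suc (toℕ-inject₁ i)

module _ {n : ℕ} where

  NorthEast SouthWest StrictlySouthWest : Permutation′ n → Fin n → Fin n → Fin n → Set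
  NorthEast π i j a = toℕ a ≤ toℕ i × toℕ j ≤ toℕ (π ⟨$⟩ʳ a)
  SouthWest π i j a = toℕ i ≤ toℕ a × toℕ (π ⟨$⟩ʳ a) ≤ toℕ j
  StrictlySouthWest π i j a = ¬ toℕ a ≤ toℕ i × ¬ toℕ j ≤ toℕ (π ⟨$⟩ʳ a)

  private
    rowAtMost? : (i : Fin n) → Decidable (λ (a : Fin n) → toℕ a ≤ toℕ i)
    rowAtMost? i a = toℕ a ≤? toℕ i

    valueAtLeast? : (π : Permutation′ n) (j : Fin n) →
      Decidable (λ (a : Fin n) → toℕ j ≤ toℕ (π ⟨$⟩ʳ a))
    valueAtLeast? π j a = toℕ j ≤? toℕ (π ⟨$⟩ʳ a)

    strictlySouthWest? : (π : Permutation′ n) (i j : Fin n) → Decidable (StrictlySouthWest π i j)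
    strictlySouthWest? π i j = ∁? (rowAtMost? i) ∩? ∁? (valueAtLeast? π j)

  southWestCount : Permutation′ n → Fin n → Fin n → ℕ
  southWestCount π i j = length (filter (strictlySouthWest? π i j) (allFin n))

  -- Inclusion–exclusion gives rankCount π i j + |{a : π a < j}| = (i + 1) + southWestCount π i j,
  -- and the middle term does not depend on the permutation π.
  ≤B⇒southWestCount-≤ : ∀ {σ ρ} → σ ≤B ρ → ∀ i j → southWestCount σ i j ≤ southWestCount ρ i j
  ≤B⇒southWestCount-≤ {σ} {ρ} σ≤ρ i j = +-cancelˡ-≤ rows _ _ (begin
    rows + southWestCount σ i j ≡⟨ inclusion-exclusion σ ⟨
    rankCount σ i j + below σ   ≡⟨ cong (rankCount σ i j +_) (trans (below-count σ) (sym (below-count ρ))) ⟩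
    rankCount σ i j + below ρ   ≤⟨ +-monoˡ-≤ (below ρ) (σ≤ρ i j) ⟩
    rankCount ρ i j + below ρ   ≡⟨ inclusion-exclusion ρ ⟩
    rows + southWestCount ρ i j ∎)
    where
    open ≤-Reasoning
    rows : ℕ
    rows = length (filter (rowAtMost? i) (allFin n))
    below : Permutation′ n → ℕ
    below π = length (filter (∁? (valueAtLeast? π j)) (allFin n))
    below-count : ∀ π → below π ≡ length (filter (λ b → ¬? (toℕ j ≤? toℕ b)) (allFin n))
    below-count = length-filter-permute (λ b → ¬? (toℕ j ≤? toℕ b))
    inclusion-exclusion : ∀ π → rankCount π i j + below π ≡ rows + southWestCount π i j
    inclusion-exclusion π =
      length-filter-inclusion-exclusion (rowAtMost? i) (valueAtLeast? π j) (allFin n)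

  ≤B-avoids-NorthEast : ∀ {σ ρ} → σ ≤B ρ → ∀ i j →
    (∀ a → ¬ NorthEast ρ i j a) → ∀ a → ¬ NorthEast σ i j a
  ≤B-avoids-NorthEast {σ} {ρ} σ≤ρ i j = length-filter-≤⇒∁-universal
    (rowAtMost? i ∩? valueAtLeast? σ j) (rowAtMost? i ∩? valueAtLeast? ρ j) (σ≤ρ i j)

  -- A permutation avoiding the south-west rectangle at (i, j) has ρ⁻¹ j north of row i
  -- and ρ i east of column j, so i > 0, j + 1 < n, and the rectangle is the strictly
  -- south-west one at (i - 1, j + 1).
  ≤B-avoids-SouthWest : ∀ {σ ρ} → σ ≤B ρ → ∀ i j →
    (∀ a → ¬ SouthWest ρ i j a) → ∀ a → ¬ SouthWest σ i j a
  ≤B-avoids-SouthWest {σ} {ρ} σ≤ρ i j ρ-avoids a = avoids (predecessor i 0<i)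
    where
    0<i : 0 < toℕ i
    0<i = ≤-trans (s≤s z≤n) (≰⇒> λ i≤ρ⁻¹j →
      ρ-avoids (ρ ⟨$⟩ˡ j) (i≤ρ⁻¹j , ≤-reflexive (cong toℕ (inverseʳ ρ))))
    1+j<n : suc (toℕ j) < n
    1+j<n = <-≤-trans (s≤s (≰⇒> λ ρi≤j → ρ-avoids i (≤-refl , ρi≤j))) (toℕ<n (ρ ⟨$⟩ʳ i))
    j′ : Fin n
    j′ = fromℕ< 1+j<n
    avoids : Σ[ i′ ∈ Fin n ] suc (toℕ i′) ≡ toℕ i → ¬ SouthWest σ i j a
    avoids (i′ , 1+i′≡i) = σ-avoids-strictly ∘ strictly-of-SouthWest σ
      where
      SouthWest-of-strictly : ∀ π b → StrictlySouthWest π i′ j′ b → SouthWest π i j b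
      SouthWest-of-strictly π b (b≰i′ , j′≰πb) =
          subst (_≤ toℕ b) 1+i′≡i (≰⇒> b≰i′)
        , ≤-pred (subst (toℕ (π ⟨$⟩ʳ b) <_) (toℕ-fromℕ< 1+j<n) (≰⇒> j′≰πb))
      strictly-of-SouthWest : ∀ π → SouthWest π i j a → StrictlySouthWest π i′ j′ a
      strictly-of-SouthWest π (i≤a , πa≤j) =
          <⇒≱ (subst (_≤ toℕ a) (sym 1+i′≡i) i≤a)
        , <⇒≱ (subst (toℕ (π ⟨$⟩ʳ a) <_) (sym (toℕ-fromℕ< 1+j<n)) (s≤s πa≤j))
      σ-avoids-strictly : ¬ StrictlySouthWest σ i′ j′ a
      σ-avoids-strictly = length-filter-≤⇒∁-universal
        (strictlySouthWest? σ i′ j′) (strictlySouthWest? ρ i′ j′)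
        (≤B⇒southWestCount-≤ {σ} {ρ} σ≤ρ i′ j′)
        (λ b → ρ-avoids b ∘ SouthWest-of-strictly ρ b) a

ferrers-rightward : ∀ {n} {A : Matrix n} → RightFerrers A →
  ∀ {i j j′} → A i j ≡ true → toℕ j ≤ toℕ j′ → A i j′ ≡ true
ferrers-rightward {zero} _ {i = ()}
ferrers-rightward {suc n} {A} ferrers {i} Aij j≤j′ =
  <-weakInduction-startingFrom (λ k → A i k ≡ true) Aij step j≤j′
  where
  step : ∀ k → A i (inject₁ k) ≡ true → A i (suc k) ≡ true
  step k Aik = proj₁ (ferrers i (inject₁ k) Aik) (suc k) (cong suc (sym (toℕ-inject₁ k)))

ferrers-upward : ∀ {n} {A : Matrix n} → RightFerrers A →
  ∀ {i i′ j} → A i j ≡ true → toℕ i′ ≤ toℕ i → A i′ j ≡ true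
ferrers-upward {zero} _ {i = ()}
ferrers-upward {suc n} {A} ferrers {i′ = i′} {j} Aij i′≤i =
  <-weakInduction-startingFrom (λ k → A k j ≡ true → A i′ j ≡ true) id step i′≤i Aij
  where
  step : ∀ k → (A (inject₁ k) j ≡ true → A i′ j ≡ true) → A (suc k) j ≡ true → A i′ j ≡ true
  step k down A₁₊ₖⱼ = down (proj₂ (ferrers (suc k) j A₁₊ₖⱼ) (inject₁ k) (cong suc (toℕ-inject₁ k)))

ferrers-northEast-closed : ∀ {n} {A : Matrix n} → RightFerrers A →
  ∀ {i j i′ j′} → A i j ≡ true → toℕ i′ ≤ toℕ i → toℕ j ≤ toℕ j′ → A i′ j′ ≡ true
ferrers-northEast-closed ferrers Aij i′≤i j≤j′ =
  ferrers-upward ferrers (ferrers-rightward ferrers Aij j≤j′) i′≤i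

∧-not-≡-true⁻ : ∀ {x y} → x ∧ not y ≡ true → x ≡ true × y ≡ false
∧-not-≡-true⁻ {true} {false} refl = refl , refl

∧-not-≡-true⁺ : ∀ {x y} → x ≡ true → y ≡ false → x ∧ not y ≡ true
∧-not-≡-true⁺ refl refl = refl

proposition4p1 : (n : ℕ) (L M : Matrix n) →
    RightFerrers L → RightFerrers M → M ≤ₘ L →
    (σ ρ : Permutation′ n) → σ ≤B ρ → InS (L ∖ₘ M) ρ → InS (L ∖ₘ M) σ
proposition4p1 n L M L-ferrers M-ferrers _ σ ρ σ≤ρ ρ∈L∖M i = ∧-not-≡-true⁺ Lic≡true Mic≡false
  where
  c : Fin n
  c = σ ⟨$⟩ʳ i
  ρ∈L : ∀ a → L a (ρ ⟨$⟩ʳ a) ≡ true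
  ρ∈L a = proj₁ (∧-not-≡-true⁻ (ρ∈L∖M a))
  ρ∉M : ∀ a → M a (ρ ⟨$⟩ʳ a) ≢ true
  ρ∉M a = not-¬ (proj₂ (∧-not-≡-true⁻ (ρ∈L∖M a)))
  Mic≡false : M i c ≡ false
  Mic≡false = ¬-not λ Mic≡true →
    ≤B-avoids-NorthEast {σ = σ} {ρ} σ≤ρ i c
      (λ a (a≤i , c≤ρa) → ρ∉M a (ferrers-northEast-closed M-ferrers Mic≡true a≤i c≤ρa))
      i (≤-refl , ≤-refl)
  Lic≡true : L i c ≡ true
  Lic≡true = ¬-not λ Lic≡false →
    ≤B-avoids-SouthWest {σ = σ} {ρ} σ≤ρ i c
      (λ a (i≤a , ρa≤c) → not-¬ Lic≡false (ferrers-northEast-closed L-ferrers (ρ∈L a) i≤a ρa≤c))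
      i (≤-refl , ≤-refl)
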